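{- Let $k\ge 1$ and let $T_k$ be the real vector space of triangular arrays $A=(a_{ij})_{0\le i\le j\le k}$ with $a_{00}=0$. Define the linear map $\Phi_k\colon T_k\to T_k$ by $\Phi_k((a_{ij}))=(h_{ij})$ with $h_{ij}=\sum_{p=0}^{i}\sum_{q=p}^{j}a_{pq}$. Then $\Phi_k$ is a volume preserving linear operator (its determinant is $1$) which maps the Littlewood-Richardson cone $\mathsf{LR}_k$ bijectively onto the hive cone $\mathsf{H}_k$, and maps $\mathsf{LR}_k(\lambda,\mu,\nu)$ onto $\mathsf{H}_k(\lambda,\mu,\nu)$ for all $\lambda,\mu,\nu\in\mathsf{D}_k$.
   Context: $T_k$ is the vector space of all labelings $A=(a_{ij})_{0\le i\le j\le k}$ by real numbers with $a_{00}=0$ (dimension $\binom{k+2}{2}-1$). $\mathsf{D}_k$ denotes the set of $k$-tuples $\lambda=(\lambda_1,\dots,\lambda_k)$ of real numbers with $\lambda_1\ge\cdots\ge\lambda_k$, and $|\lambda|=\sum_i\lambda_i$. A Littlewood-Richardson triangle of size $k$ is $A=(a_{ij})\in T_k$ satisfying: (P) $a_{ij}\ge 0$ for all $1\le i<j\le k$; (CS) $\sum_{p=0}^{i-1}a_{pj}\ge\sum_{p=0}^{i}a_{p\,j+1}$ for all $1\le i\le j<k$; (LR) $\sum_{q=i}^{j}a_{iq}\ge\sum_{q=i+1}^{j+1}a_{i+1\,q}$ for all $1\le i\le j<k$. $\mathsf{LR}_k$ is the cone of all such triangles. Its type is $(\lambda,\mu,\nu)$ where $\mu_j=a_{0j}$,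 $\lambda_j=\sum_{p=0}^{j}a_{pj}$ ($1\le j\le k$), $\nu_i=\sum_{q=i}^{k}a_{iq}$ ($1\le i\le k$); $\mathsf{LR}_k(\lambda,\mu,\nu)$ is the set of Littlewood-Richardson triangles of type $(\lambda,\mu,\nu)$. A hive of size $k$ is $H=(h_{ij})_{0\le i\le j\le k}$ of real numbers with $h_{00}=0$ satisfying: (R) $h_{ij}-h_{i\,j-1}\ge h_{i-1\,j}-h_{i-1\,j-1}$ for $1\le i<j\le k$; (V) $h_{i-1\,j}-h_{i-1\,j-1}\ge h_{i\,j+1}-h_{ij}$ for $1\le i\le j<k$; (L) $h_{ij}-h_{i-1\,j}\ge h_{i+1\,j+1}-h_{i\,j+1}$ for $1\le i\le j<k$. $\mathsf{H}_k$ is the cone of all hives of size $k$. The type of a hive is $(\lambda,\mu,\nu)$ where $\mu_j=h_{0j}-h_{0\,j-1}$, $\lambda_j=h_{jj}-h_{j-1\,j-1}$ ($1\le j\le k$), $\nu_i=h_{ik}-h_{i-1\,k}$ ($1\le i\le k$); $\mathsf{H}_k(\lambda,\mu,\nu)$ is the set of hives of type $(\lambda,\mu,\nu)$. -}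

module Defs where

open import Level using (Level; _⊔_) renaming (suc to lsuc)
open import Data.Nat using (ℕ; zero; suc; _∸_) renaming (_≤_ to _≤ℕ_; _<_ to _<ℕ_; _≟_ to _≟ℕ_)
open import Data.Fin using (Fin; zero; suc; punchIn)
open import Data.Product using (_×_; _,_; ∃)
open import Data.List using (List; []; _∷_; _++_; length; lookup; map; upTo)
open import Data.Bool using (true; false)
open import Relation.Nullary using (¬_; yes; no)
open import Relation.Binary using (Rel; IsTotalOrder)
open import Algebra.Bundles using (CommutativeRing)

-- An ordered field (the paper works over ℝ; we state the result for an
-- arbitrary ordered field, ℝ being one instance).
record OrderedField (c ℓ₁ ℓ₂ : Level) : Set (lsuc (c ⊔ ℓ₁ ⊔ ℓ₂)) where
  field
    commutativeRing : CommutativeRing c ℓ₁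
  open CommutativeRing commutativeRing public
  field
    _≤_          : Rel Carrier ℓ₂
    isTotalOrder : IsTotalOrder _≈_ _≤_
    +-monoˡ-≤    : ∀ {x y} z → x ≤ y → (x + z) ≤ (y + z)
    *-nonneg     : ∀ {x y} → 0# ≤ x → 0# ≤ y → 0# ≤ (x * y)
    0≉1          : ¬ (0# ≈ 1#)
    inverse      : ∀ x → ¬ (x ≈ 0#) → ∃ λ y → (x * y) ≈ 1#

-- index set {(i,j) : 0 ≤ i ≤ j ≤ k, (i,j) ≠ (0,0)} of T_k, listed column by column
indices : ℕ → List (ℕ × ℕ)
indices zero    = []
indices (suc k) = indices k ++ map (λ i → (i , suc k)) (upTo (suc (suc k)))

module _ {c ℓ₁ ℓ₂} (F : OrderedField c ℓ₁ ℓ₂) where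
  open OrderedField F hiding (zero)

  -- Triangular arrays: values at (i , j) with 0 ≤ i ≤ j ≤ k are relevant,
  -- all other values are ignored.
  Array : Set c
  Array = ℕ → ℕ → Carrier

  InT : Array → Set ℓ₁
  InT A = A 0 0 ≈ 0#

  EqT : ℕ → Array → Array → Set ℓ₁
  EqT k A B = ∀ i j → i ≤ℕ j → j ≤ℕ k → A i j ≈ B i j

  -- Σ_{p=a}^{b} f p   (empty sum = 0 if b < a)
  sumFT : (ℕ → Carrier) → ℕ → ℕ → Carrier
  sumFT f a b = go (suc b ∸ a) a
    where
    go : ℕ → ℕ → Carrier
    go zero    m = 0#
    go (suc n) m = f m + go n (suc m)

  Φ : Array → Array
  Φ A i j = sumFT (λ p → sumFT (λ q → A p q) p j) 0 i

  -- D_k : weakly decreasing k-tuples (indexed 1..k)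
  InD : ℕ → (ℕ → Carrier) → Set ℓ₂
  InD k l = ∀ i → 1 ≤ℕ i → i <ℕ k → l (suc i) ≤ l i

  record IsLR (k : ℕ) (A : Array) : Set (ℓ₁ ⊔ ℓ₂) where
    field
      a00 : A 0 0 ≈ 0#
      P   : ∀ i j → 1 ≤ℕ i → i <ℕ j → j ≤ℕ k → 0# ≤ A i j
      CS  : ∀ i j → 1 ≤ℕ i → i ≤ℕ j → j <ℕ k →
            sumFT (λ p → A p (suc j)) 0 i ≤ sumFT (λ p → A p j) 0 (i ∸ 1)
      LR  : ∀ i j → 1 ≤ℕ i → i ≤ℕ j → j <ℕ k →
            sumFT (λ q → A (suc i) q) (suc i) (suc j) ≤ sumFT (λ q → A i q) i j

  record LRType (k : ℕ) (A : Array) (lam mu nu : ℕ → Carrier) : Set ℓ₁ where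
    field
      μ-eq : ∀ j → 1 ≤ℕ j → j ≤ℕ k → mu j ≈ A 0 j
      λ-eq : ∀ j → 1 ≤ℕ j → j ≤ℕ k → lam j ≈ sumFT (λ p → A p j) 0 j
      ν-eq : ∀ i → 1 ≤ℕ i → i ≤ℕ k → nu i ≈ sumFT (λ q → A i q) i k

  record IsHive (k : ℕ) (H : Array) : Set (ℓ₁ ⊔ ℓ₂) where
    field
      h00 : H 0 0 ≈ 0#
      R   : ∀ i j → 1 ≤ℕ i → i <ℕ j → j ≤ℕ k →
            (H (i ∸ 1) j - H (i ∸ 1) (j ∸ 1)) ≤ (H i j - H i (j ∸ 1))
      V   : ∀ i j → 1 ≤ℕ i → i ≤ℕ j → j <ℕ k →
            (H i (suc j) - H i j) ≤ (H (i ∸ 1) j - H (i ∸ 1) (j ∸ 1))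
      L   : ∀ i j → 1 ≤ℕ i → i ≤ℕ j → j <ℕ k →
            (H (suc i) (suc j) - H i (suc j)) ≤ (H i j - H (i ∸ 1) j)

  record HiveType (k : ℕ) (H : Array) (lam mu nu : ℕ → Carrier) : Set ℓ₁ where
    field
      μ-eq : ∀ j → 1 ≤ℕ j → j ≤ℕ k → mu j ≈ (H 0 j - H 0 (j ∸ 1))
      λ-eq : ∀ j → 1 ≤ℕ j → j ≤ℕ k → lam j ≈ (H j j - H (j ∸ 1) (j ∸ 1))
      ν-eq : ∀ i → 1 ≤ℕ i → i ≤ℕ k → nu i ≈ (H i k - H (i ∸ 1) k)

  sign : ∀ {n} → Fin n → Carrier
  sign zero    = 1#
  sign (suc c) = - sign c

  det : ∀ n → (Fin n → Fin n → Carrier) → Carrier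
  det zero    M = 1#
  det (suc n) M = sumFin (λ c → sign c * (M zero c * det n (λ r c' → M (suc r) (punchIn c c'))))
    where
    sumFin : ∀ {m} → (Fin m → Carrier) → Carrier
    sumFin {zero}  f = 0#
    sumFin {suc m} f = f zero + sumFin (λ x → f (suc x))

  basis : ℕ × ℕ → Array
  basis (p , q) i j with p ≟ℕ i | q ≟ℕ j
  ... | yes _ | yes _ = 1#
  ... | _     | _     = 0#

  MatΦ : (k : ℕ) → Fin (length (indices k)) → Fin (length (indices k)) → Carrier
  MatΦ k r c with lookup (indices k) r | lookup (indices k) c
  ... | (i , j) | x = Φ (basis x) i j

{-# OPTIONS --safe #-}
-- Φ is partial summation in both directions: h_ij sums the row sums Σ_{q=p}^{j} a_pq
-- over p ≤ i.  Hence the first differences of Φ(A) along a row, a column and the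
-- diagonal are column sums, row sums and entries of A, which turns the hive conditions
-- R, V, L into the conditions P, CS, LR and the hive type into the LR type.  Partial
-- summation is inverted by taking differences, so Φ is a bijection of T_k.  Finally
-- Φ(e_(p,q)) is supported on {(i , j) : p ≤ i, q ≤ j} and equals 1 at (p , q), so in
-- the column-by-column enumeration of the basis the matrix of Φ is unitriangular.
module Submission where

open import Defs
open import Data.Nat using (ℕ; zero; suc; _∸_; z≤n; s≤s)
  renaming (_≤_ to _≤ℕ_; _<_ to _<ℕ_; _+_ to _+ℕ_)
import Data.Nat.Properties as ℕ
open import Data.Fin using (Fin; zero; suc; punchIn) renaming (_<_ to _<ᶠ_)
open import Data.List using (lookup; length)
open import Data.List.Relation.Unary.All using (All)
import Data.List.Relation.Unary.All as All
import Data.List.Relation.Unary.All.Properties as Allₚ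
open import Data.List.Relation.Unary.AllPairs using (AllPairs; _∷_)
import Data.List.Relation.Unary.AllPairs.Properties as AllPairsₚ
open import Data.List.Membership.Propositional.Properties using (∈-lookup)
open import Data.Product using (_×_; Σ; _,_; proj₁; proj₂)
open import Data.Sum using (_⊎_; inj₁; inj₂)
open import Function using (id; _⇔_; mk⇔; Equivalence)
open import Function.Properties.Equivalence using () renaming (trans to ⇔-trans)
open import Relation.Nullary using (¬_; yes; no; contradiction)
open import Relation.Binary using (IsTotalOrder)
open import Relation.Binary.PropositionalEquality as ≡ using (_≡_; ≢-sym)

inSegment⇒≤ : ∀ {a b t} → a ≤ℕ t → t <ℕ a +ℕ (suc b ∸ a) → t ≤ℕ b
inSegment⇒≤ {a} {b} {t} a≤t t<end with a ℕ.≤? suc b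
... | yes a≤1+b = ℕ.≤-pred (≡.subst (t <ℕ_) (ℕ.m+[n∸m]≡n a≤1+b) t<end)
... | no  a≰1+b = contradiction (≡.subst (t <ℕ_) a+[1+b∸a]≡a t<end) (ℕ.≤⇒≯ a≤t)
  where
  a+[1+b∸a]≡a : a +ℕ (suc b ∸ a) ≡ a
  a+[1+b∸a]≡a = ≡.trans (≡.cong (a +ℕ_) (ℕ.m≤n⇒m∸n≡0 (ℕ.<⇒≤ (ℕ.≰⇒> a≰1+b)))) (ℕ.+-identityʳ a)

≤⇒inSegment : ∀ {a b t} → a ≤ℕ t → t ≤ℕ b → t <ℕ a +ℕ (suc b ∸ a)
≤⇒inSegment {a} {b} {t} a≤t t≤b =
  ≡.subst (t <ℕ_) (≡.sym (ℕ.m+[n∸m]≡n (ℕ.≤-trans a≤t (ℕ.m≤n⇒m≤1+n t≤b)))) (s≤s t≤b)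

_≰ₓ_ : ℕ × ℕ → ℕ × ℕ → Set
(p , q) ≰ₓ (i , j) = i <ℕ p ⊎ j <ℕ q

InTriangle : ℕ → ℕ × ℕ → Set
InTriangle k (i , j) = i ≤ℕ j × j ≤ℕ k

indices-inTriangle : ∀ k → All (InTriangle k) (indices k)
indices-inTriangle zero    = All.[]
indices-inTriangle (suc k) = Allₚ.++⁺
  (All.map (λ (i≤j , j≤k) → i≤j , ℕ.m≤n⇒m≤1+n j≤k) (indices-inTriangle k))
  (Allₚ.map⁺ (Allₚ.applyUpTo⁺₁ id (suc (suc k)) (λ i<2+k → ℕ.≤-pred i<2+k , ℕ.≤-refl)))

indices-linearExtension : ∀ k → AllPairs (λ x y → y ≰ₓ x) (indices k)
indices-linearExtension zero    = AllPairs.[]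
indices-linearExtension (suc k) = AllPairsₚ.++⁺
  (indices-linearExtension k)
  (AllPairsₚ.map⁺ (AllPairsₚ.applyUpTo⁺₁ id (suc (suc k)) (λ i<j _ → inj₁ i<j)))
  (All.map (λ (_ , j≤k) → Allₚ.map⁺ (Allₚ.applyUpTo⁺₂ id (suc (suc k)) (λ _ → inj₂ (s≤s j≤k))))
           (indices-inTriangle k))

lookup-AllPairs : ∀ {a r} {A : Set a} {R : A → A → Set r} {xs} → AllPairs R xs →
                  ∀ {i j : Fin (length xs)} → i <ᶠ j → R (lookup xs i) (lookup xs j)
lookup-AllPairs (Rx ∷ _)  {zero}  {suc j} _         = All.lookup Rx (∈-lookup j)
lookup-AllPairs (_ ∷ Rxs) {suc i} {suc j} (s≤s i<j) = lookup-AllPairs Rxs i<j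

module _ {c ℓ₁ ℓ₂} (F : OrderedField c ℓ₁ ℓ₂) where
  open OrderedField F hiding (zero)
  open IsTotalOrder isTotalOrder using (≤-respˡ-≈; ≤-respʳ-≈)
  open import Algebra.Properties.Group +-group using (∙-cancelˡ; //-cong₂; //-rightDividesˡ; //-rightDividesʳ)
  open import Algebra.Properties.Monoid.Sum +-monoid using (sum; sum-cong-≋; sum-replicate-zero)
  open import Algebra.Properties.CommutativeSemigroup +-commutativeSemigroup using (interchange)
  open import Relation.Binary.Reasoning.Setoid setoid

  x≈y+z⇒x-y≈z : ∀ {x y z} → x ≈ y + z → x - y ≈ z
  x≈y+z⇒x-y≈z {x} {y} {z} x≈y+z = begin
    x - y        ≈⟨ +-congʳ (trans x≈y+z (+-comm y z)) ⟩
    (z + y) - y  ≈⟨ //-rightDividesʳ y z ⟩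
    z            ∎

  x+[y-x]≈y : ∀ x y → x + (y - x) ≈ y
  x+[y-x]≈y x y = trans (+-comm x (y - x)) (//-rightDividesˡ x y)

  ≤-resp₂ : ∀ {x x′ y y′} → x ≈ x′ → y ≈ y′ → x ≤ y → x′ ≤ y′
  ≤-resp₂ x≈x′ y≈y′ x≤y = ≤-respʳ-≈ y≈y′ (≤-respˡ-≈ x≈x′ x≤y)

  ≤-resp₂-⇔ : ∀ {x x′ y y′} → x ≈ x′ → y ≈ y′ → (x ≤ y) ⇔ (x′ ≤ y′)
  ≤-resp₂-⇔ x≈x′ y≈y′ = mk⇔ (≤-resp₂ x≈x′ y≈y′) (≤-resp₂ (sym x≈x′) (sym y≈y′))

  0≤a⇔x≤x+a : ∀ x a → (0# ≤ a) ⇔ (x ≤ (x + a))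
  0≤a⇔x≤x+a x a = mk⇔
    (λ 0≤a → ≤-resp₂ (+-identityˡ x) (+-comm a x) (+-monoˡ-≤ x 0≤a))
    (λ x≤x+a → ≤-resp₂ (-‿inverseʳ x) (x≈y+z⇒x-y≈z refl) (+-monoˡ-≤ (- x) x≤x+a))

  sumFrom : (ℕ → Carrier) → ℕ → ℕ → Carrier
  sumFrom f zero    m = 0#
  sumFrom f (suc n) m = f m + sumFrom f n (suc m)

  -- `sumFT` runs a local loop that cannot be named; the underscore is solved to that
  -- loop by unification in `sumFT≡sumFrom`.  The loop is parameterised by a and b,
  -- hence the unused arguments.
  mutual
    loop≡sumFrom : ∀ f (a b n m : ℕ) → _ ≡ sumFrom f n m
    loop≡sumFrom f a b zero    m = ≡.refl
    loop≡sumFrom f a b (suc n) m = ≡.cong (f m +_) (loop≡sumFrom f a b n (suc m))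

    sumFT≡sumFrom : ∀ f a b → sumFT F f a b ≡ sumFrom f (suc b ∸ a) a
    sumFT≡sumFrom f a b with suc b ∸ a
    ... | zero  = ≡.refl
    ... | suc n with suc a
    ...   | m = ≡.cong (f a +_) (loop≡sumFrom f a b n m)

  OnSegment : (ℕ → Set ℓ₁) → ℕ → ℕ → Set ℓ₁
  OnSegment P n m = ∀ t → m ≤ℕ t → t <ℕ m +ℕ n → P t

  OnSegment-head : ∀ {P n m} → OnSegment P (suc n) m → P m
  OnSegment-head {n = n} {m} Pt = Pt m ℕ.≤-refl (ℕ.m<m+n m (s≤s z≤n))

  OnSegment-tail : ∀ {P n m} → OnSegment P (suc n) m → OnSegment P n (suc m)
  OnSegment-tail {n = n} {m} Pt t m<t t<end =
    Pt t (ℕ.<⇒≤ m<t) (≡.subst (t <ℕ_) (≡.sym (ℕ.+-suc m n)) t<end)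

  OnSegment-fromRange : ∀ {P} a b → (∀ t → a ≤ℕ t → t ≤ℕ b → P t) → OnSegment P (suc b ∸ a) a
  OnSegment-fromRange a b Pt t a≤t t<end = Pt t a≤t (inSegment⇒≤ a≤t t<end)

  sumFrom-cong : ∀ {f g} n m → OnSegment (λ t → f t ≈ g t) n m → sumFrom f n m ≈ sumFrom g n m
  sumFrom-cong zero    m _   = refl
  sumFrom-cong (suc n) m f≈g =
    +-cong (OnSegment-head f≈g) (sumFrom-cong n (suc m) (OnSegment-tail f≈g))

  sumFrom-zero : ∀ {f} n m → OnSegment (λ t → f t ≈ 0#) n m → sumFrom f n m ≈ 0#
  sumFrom-zero zero    m _   = refl
  sumFrom-zero (suc n) m f≈0 =
    trans (+-cong (OnSegment-head f≈0) (sumFrom-zero n (suc m) (OnSegment-tail f≈0))) (+-identityʳ 0#)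

  sumFrom-single : ∀ {f} n m {t₀} → m ≤ℕ t₀ → t₀ <ℕ m +ℕ n →
                   OnSegment (λ t → ¬ t ≡ t₀ → f t ≈ 0#) n m → sumFrom f n m ≈ f t₀
  sumFrom-single zero m m≤t₀ t₀<m+0 _ =
    contradiction (≡.subst (_ <ℕ_) (ℕ.+-identityʳ m) t₀<m+0) (ℕ.≤⇒≯ m≤t₀)
  sumFrom-single {f} (suc n) m {t₀} m≤t₀ t₀<end f≈0 with m ℕ.≟ t₀
  ... | yes ≡.refl = trans (+-congˡ (sumFrom-zero n (suc m) rest≈0)) (+-identityʳ (f m))
    where
    rest≈0 : OnSegment (λ t → f t ≈ 0#) n (suc m)
    rest≈0 t m<t t<end = OnSegment-tail f≈0 t m<t t<end (λ t≡m → ℕ.<-irrefl (≡.sym t≡m) m<t)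
  ... | no  m≢t₀ =
    trans (+-cong (OnSegment-head f≈0 m≢t₀)
                  (sumFrom-single n (suc m) (ℕ.≤∧≢⇒< m≤t₀ m≢t₀)
                                  (≡.subst (t₀ <ℕ_) (ℕ.+-suc m n) t₀<end) (OnSegment-tail f≈0)))
          (+-identityˡ (f t₀))

  sumFrom-snoc : ∀ f n m → sumFrom f (suc n) m ≈ sumFrom f n m + f (m +ℕ n)
  sumFrom-snoc f zero    m = begin
    f m + 0#        ≈⟨ +-comm (f m) 0# ⟩
    0# + f m        ≡⟨ ≡.cong (λ t → 0# + f t) (≡.sym (ℕ.+-identityʳ m)) ⟩
    0# + f (m +ℕ 0) ∎
  sumFrom-snoc f (suc n) m = begin
    f m + sumFrom f (suc n) (suc m)                ≈⟨ +-congˡ (sumFrom-snoc f n (suc m)) ⟩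
    f m + (sumFrom f n (suc m) + f (suc m +ℕ n))   ≈⟨ +-assoc (f m) _ _ ⟨
    (f m + sumFrom f n (suc m)) + f (suc m +ℕ n)
      ≡⟨ ≡.cong (λ t → (f m + sumFrom f n (suc m)) + f t) (≡.sym (ℕ.+-suc m n)) ⟩
    (f m + sumFrom f n (suc m)) + f (m +ℕ suc n)   ∎

  sumFrom-distrib-+ : ∀ f g n m → sumFrom (λ t → f t + g t) n m ≈ sumFrom f n m + sumFrom g n m
  sumFrom-distrib-+ f g zero    m = sym (+-identityʳ 0#)
  sumFrom-distrib-+ f g (suc n) m = trans (+-congˡ (sumFrom-distrib-+ f g n (suc m))) (interchange _ _ _ _)

  sumFT≈sumFrom : ∀ f a b → sumFT F f a b ≈ sumFrom f (suc b ∸ a) a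
  sumFT≈sumFrom f a b = reflexive (sumFT≡sumFrom f a b)

  sumFT-cong : ∀ {f g} a b → (∀ t → a ≤ℕ t → t ≤ℕ b → f t ≈ g t) → sumFT F f a b ≈ sumFT F g a b
  sumFT-cong {f} {g} a b f≈g = begin
    sumFT F f a b            ≈⟨ sumFT≈sumFrom f a b ⟩
    sumFrom f (suc b ∸ a) a  ≈⟨ sumFrom-cong (suc b ∸ a) a (OnSegment-fromRange a b f≈g) ⟩
    sumFrom g (suc b ∸ a) a  ≈⟨ sumFT≈sumFrom g a b ⟨
    sumFT F g a b            ∎

  sumFT-zero : ∀ {f} a b → (∀ t → a ≤ℕ t → t ≤ℕ b → f t ≈ 0#) → sumFT F f a b ≈ 0#
  sumFT-zero {f} a b f≈0 =
    trans (sumFT≈sumFrom f a b) (sumFrom-zero (suc b ∸ a) a (OnSegment-fromRange a b f≈0))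

  sumFT-single : ∀ {f} a b {t₀} → a ≤ℕ t₀ → t₀ ≤ℕ b →
                 (∀ t → a ≤ℕ t → t ≤ℕ b → ¬ t ≡ t₀ → f t ≈ 0#) → sumFT F f a b ≈ f t₀
  sumFT-single {f} a b a≤t₀ t₀≤b f≈0 = trans (sumFT≈sumFrom f a b)
    (sumFrom-single (suc b ∸ a) a a≤t₀ (≤⇒inSegment a≤t₀ t₀≤b) (OnSegment-fromRange a b f≈0))

  sumFT-one : ∀ f a → sumFT F f a a ≈ f a
  sumFT-one f a = sumFT-single a a ℕ.≤-refl ℕ.≤-refl
    (λ t a≤t t≤a t≢a → contradiction (ℕ.≤-antisym t≤a a≤t) t≢a)

  sumFT-distrib-+ : ∀ f g a b → sumFT F (λ t → f t + g t) a b ≈ sumFT F f a b + sumFT F g a b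
  sumFT-distrib-+ f g a b = begin
    sumFT F (λ t → f t + g t) a b                       ≈⟨ sumFT≈sumFrom _ a b ⟩
    sumFrom (λ t → f t + g t) (suc b ∸ a) a             ≈⟨ sumFrom-distrib-+ f g (suc b ∸ a) a ⟩
    sumFrom f (suc b ∸ a) a + sumFrom g (suc b ∸ a) a   ≈⟨ +-cong (sumFT≈sumFrom f a b) (sumFT≈sumFrom g a b) ⟨
    sumFT F f a b + sumFT F g a b                       ∎

  sumFT-snoc : ∀ f {a} b → a ≤ℕ suc b → sumFT F f a (suc b) ≈ sumFT F f a b + f (suc b)
  sumFT-snoc f {a} b a≤1+b = begin
    sumFT F f a (suc b)                          ≈⟨ sumFT≈sumFrom f a (suc b) ⟩
    sumFrom f (suc (suc b) ∸ a) a                ≡⟨ ≡.cong (λ n → sumFrom f n a) (ℕ.+-∸-assoc 1 a≤1+b) ⟩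
    sumFrom f (suc (suc b ∸ a)) a                ≈⟨ sumFrom-snoc f (suc b ∸ a) a ⟩
    sumFrom f (suc b ∸ a) a + f (a +ℕ (suc b ∸ a))
      ≡⟨ ≡.cong (λ t → sumFrom f (suc b ∸ a) a + f t) (ℕ.m+[n∸m]≡n a≤1+b) ⟩
    sumFrom f (suc b ∸ a) a + f (suc b)          ≈⟨ +-congʳ (sumFT≈sumFrom f a b) ⟨
    sumFT F f a b + f (suc b)                    ∎

  sumFT-injective : ∀ {f g} a n → (∀ b → a ≤ℕ b → b ≤ℕ n → sumFT F f a b ≈ sumFT F g a b) →
                    ∀ t → a ≤ℕ t → t ≤ℕ n → f t ≈ g t
  sumFT-injective {f} {g} a n same t a≤t t≤n with ℕ.m≤n⇒m<n∨m≡n a≤t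
  ... | inj₂ ≡.refl = begin
    f a            ≈⟨ sumFT-one f a ⟨
    sumFT F f a a  ≈⟨ same a a≤t t≤n ⟩
    sumFT F g a a  ≈⟨ sumFT-one g a ⟩
    g a            ∎
  sumFT-injective {f} {g} a n same (suc t) _ 1+t≤n | inj₁ (s≤s a≤t) =
    ∙-cancelˡ (sumFT F f a t) (f (suc t)) (g (suc t)) (begin
      sumFT F f a t + f (suc t)  ≈⟨ sumFT-snoc f t (ℕ.m≤n⇒m≤1+n a≤t) ⟨
      sumFT F f a (suc t)        ≈⟨ same (suc t) (ℕ.m≤n⇒m≤1+n a≤t) 1+t≤n ⟩
      sumFT F g a (suc t)        ≈⟨ sumFT-snoc g t (ℕ.m≤n⇒m≤1+n a≤t) ⟩
      sumFT F g a t + g (suc t)  ≈⟨ +-congʳ (same t a≤t (ℕ.≤-trans (ℕ.n≤1+n t) 1+t≤n)) ⟨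
      sumFT F f a t + g (suc t)  ∎)

  -- Inverse of partial summation from a; the values at t < a are irrelevant.
  Δ : ℕ → (ℕ → Carrier) → ℕ → Carrier
  Δ a g t with t ℕ.≤? a
  ... | yes _ = g t
  ... | no  _ = g t - g (t ∸ 1)

  Δ-anchor : ∀ a g → Δ a g a ≈ g a
  Δ-anchor a g with a ℕ.≤? a
  ... | yes _   = refl
  ... | no  a≰a = contradiction ℕ.≤-refl a≰a

  Δ-suc : ∀ {a} g t → a ≤ℕ t → Δ a g (suc t) ≈ g (suc t) - g t
  Δ-suc {a} g t a≤t with suc t ℕ.≤? a
  ... | yes 1+t≤a = contradiction a≤t (ℕ.<⇒≱ 1+t≤a)
  ... | no  _     = refl

  sumFT-Δ : ∀ {a} g b → a ≤ℕ b → sumFT F (Δ a g) a b ≈ g b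
  sumFT-Δ {a} g b a≤b with ℕ.m≤n⇒m<n∨m≡n a≤b
  ... | inj₂ ≡.refl = trans (sumFT-one (Δ a g) a) (Δ-anchor a g)
  sumFT-Δ {a} g (suc b) _ | inj₁ (s≤s a≤b) = begin
    sumFT F (Δ a g) a (suc b)               ≈⟨ sumFT-snoc (Δ a g) b (ℕ.m≤n⇒m≤1+n a≤b) ⟩
    sumFT F (Δ a g) a b + Δ a g (suc b)     ≈⟨ +-cong (sumFT-Δ g b a≤b) (Δ-suc g b a≤b) ⟩
    g b + (g (suc b) - g b)                 ≈⟨ x+[y-x]≈y (g b) (g (suc b)) ⟩
    g (suc b)                               ∎

  col : Array F → ℕ → ℕ → Carrier
  col A i j = sumFT F (λ p → A p j) 0 i

  row : Array F → ℕ → ℕ → Carrier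
  row A i j = sumFT F (A i) i j

  col-snoc : ∀ A i j → col A (suc i) j ≈ col A i j + A (suc i) j
  col-snoc A i j = sumFT-snoc (λ p → A p j) i z≤n

  Φ-row-snoc : ∀ A i j → Φ F A (suc i) j ≈ Φ F A i j + row A (suc i) j
  Φ-row-snoc A i j = sumFT-snoc (λ p → row A p j) i z≤n

  Φ-col-snoc : ∀ A {i} j → i ≤ℕ suc j → Φ F A i (suc j) ≈ Φ F A i j + col A i (suc j)
  Φ-col-snoc A {i} j i≤1+j = begin
    Φ F A i (suc j)
      ≈⟨ sumFT-cong 0 i (λ p _ p≤i → sumFT-snoc (A p) j (ℕ.≤-trans p≤i i≤1+j)) ⟩
    sumFT F (λ p → row A p j + A p (suc j)) 0 i  ≈⟨ sumFT-distrib-+ (λ p → row A p j) (λ p → A p (suc j)) 0 i ⟩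
    Φ F A i j + col A i (suc j)                  ∎

  Φ-00 : ∀ A → Φ F A 0 0 ≈ A 0 0
  Φ-00 A = trans (sumFT-one (λ p → row A p 0) 0) (sumFT-one (A 0) 0)

  Φ-Δrow : ∀ A i j → Φ F A (suc i) j - Φ F A i j ≈ row A (suc i) j
  Φ-Δrow A i j = x≈y+z⇒x-y≈z (Φ-row-snoc A i j)

  Φ-Δcol : ∀ A {i} j → i ≤ℕ suc j → Φ F A i (suc j) - Φ F A i j ≈ col A i (suc j)
  Φ-Δcol A j i≤1+j = x≈y+z⇒x-y≈z (Φ-col-snoc A j i≤1+j)

  Φ-Δtop : ∀ A j → Φ F A 0 (suc j) - Φ F A 0 j ≈ A 0 (suc j)
  Φ-Δtop A j = trans (Φ-Δcol A j z≤n) (sumFT-one (λ p → A p (suc j)) 0)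

  Φ-Δdiag : ∀ A j → Φ F A (suc j) (suc j) - Φ F A j j ≈ col A (suc j) (suc j)
  Φ-Δdiag A j = x≈y+z⇒x-y≈z (begin
    Φ F A (suc j) (suc j)                               ≈⟨ Φ-row-snoc A j (suc j) ⟩
    Φ F A j (suc j) + row A (suc j) (suc j)
      ≈⟨ +-cong (Φ-col-snoc A j (ℕ.n≤1+n j)) (sumFT-one (A (suc j)) (suc j)) ⟩
    (Φ F A j j + col A j (suc j)) + A (suc j) (suc j)   ≈⟨ +-assoc _ _ _ ⟩
    Φ F A j j + (col A j (suc j) + A (suc j) (suc j))   ≈⟨ +-congˡ (col-snoc A j (suc j)) ⟨
    Φ F A j j + col A (suc j) (suc j)                   ∎)

  P⇔R : ∀ A {i j} → i ≤ℕ j →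
        (0# ≤ A (suc i) (suc j)) ⇔
        ((Φ F A i (suc j) - Φ F A i j) ≤ (Φ F A (suc i) (suc j) - Φ F A (suc i) j))
  P⇔R A {i} {j} i≤j = ⇔-trans (0≤a⇔x≤x+a (col A i (suc j)) (A (suc i) (suc j)))
    (≤-resp₂-⇔ (sym (Φ-Δcol A j (ℕ.m≤n⇒m≤1+n i≤j)))
               (sym (trans (Φ-Δcol A j (s≤s i≤j)) (col-snoc A i (suc j)))))

  CS⇔V : ∀ A {i j} → i ≤ℕ j →
         (col A (suc i) (suc (suc j)) ≤ col A i (suc j)) ⇔
         ((Φ F A (suc i) (suc (suc j)) - Φ F A (suc i) (suc j)) ≤ (Φ F A i (suc j) - Φ F A i j))
  CS⇔V A {i} {j} i≤j = ≤-resp₂-⇔ (sym (Φ-Δcol A (suc j) (s≤s (ℕ.m≤n⇒m≤1+n i≤j))))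
                                  (sym (Φ-Δcol A j (ℕ.m≤n⇒m≤1+n i≤j)))

  LR⇔L : ∀ A i j →
         (row A (suc (suc i)) (suc j) ≤ row A (suc i) j) ⇔
         ((Φ F A (suc (suc i)) (suc j) - Φ F A (suc i) (suc j)) ≤ (Φ F A (suc i) j - Φ F A i j))
  LR⇔L A i j = ≤-resp₂-⇔ (sym (Φ-Δrow A (suc i) (suc j))) (sym (Φ-Δrow A i j))

  IsLR⇒IsHive : ∀ {k A} → IsLR F k A → IsHive F k (Φ F A)
  IsLR⇒IsHive {A = A} lr = record
    { h00 = trans (Φ-00 A) a00
    ; R   = λ { (suc i) (suc j) 1≤i i<j@(s≤s i<j′) j≤k →
                  Equivalence.to (P⇔R A (ℕ.<⇒≤ i<j′)) (P (suc i) (suc j) 1≤i i<j j≤k) }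
    ; V   = λ { (suc i) (suc j) 1≤i i≤j@(s≤s i≤j′) j<k →
                  Equivalence.to (CS⇔V A i≤j′) (CS (suc i) (suc j) 1≤i i≤j j<k) }
    ; L   = λ { (suc i) j 1≤i i≤j j<k → Equivalence.to (LR⇔L A i j) (LR (suc i) j 1≤i i≤j j<k) }
    }
    where open IsLR lr

  IsHive⇒IsLR : ∀ {k A} → IsHive F k (Φ F A) → IsLR F k A
  IsHive⇒IsLR {A = A} hive = record
    { a00 = trans (sym (Φ-00 A)) h00
    ; P   = λ { (suc i) (suc j) 1≤i i<j@(s≤s i<j′) j≤k →
                  Equivalence.from (P⇔R A (ℕ.<⇒≤ i<j′)) (R (suc i) (suc j) 1≤i i<j j≤k) }
    ; CS  = λ { (suc i) (suc j) 1≤i i≤j@(s≤s i≤j′) j<k →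
                  Equivalence.from (CS⇔V A i≤j′) (V (suc i) (suc j) 1≤i i≤j j<k) }
    ; LR  = λ { (suc i) j 1≤i i≤j j<k → Equivalence.from (LR⇔L A i j) (L (suc i) j 1≤i i≤j j<k) }
    }
    where open IsHive hive

  LRType⇒HiveType : ∀ {k A lam mu nu} → LRType F k A lam mu nu → HiveType F k (Φ F A) lam mu nu
  LRType⇒HiveType {k} {A} type = record
    { μ-eq = λ { (suc j) 1≤j j≤k → trans (μ-eq (suc j) 1≤j j≤k) (sym (Φ-Δtop A j)) }
    ; λ-eq = λ { (suc j) 1≤j j≤k → trans (λ-eq (suc j) 1≤j j≤k) (sym (Φ-Δdiag A j)) }
    ; ν-eq = λ { (suc i) 1≤i i≤k → trans (ν-eq (suc i) 1≤i i≤k) (sym (Φ-Δrow A i k)) }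
    }
    where open LRType type

  HiveType⇒LRType : ∀ {k A lam mu nu} → HiveType F k (Φ F A) lam mu nu → LRType F k A lam mu nu
  HiveType⇒LRType {k} {A} type = record
    { μ-eq = λ { (suc j) 1≤j j≤k → trans (μ-eq (suc j) 1≤j j≤k) (Φ-Δtop A j) }
    ; λ-eq = λ { (suc j) 1≤j j≤k → trans (λ-eq (suc j) 1≤j j≤k) (Φ-Δdiag A j) }
    ; ν-eq = λ { (suc i) 1≤i i≤k → trans (ν-eq (suc i) 1≤i i≤k) (Φ-Δrow A i k) }
    }
    where open HiveType type

  module _ {k} {H H′ : Array F} (H≈H′ : EqT F k H H′) where

    ≈-along-row : ∀ {i j} → i ≤ℕ j → suc j ≤ℕ k → H i (suc j) - H i j ≈ H′ i (suc j) - H′ i j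
    ≈-along-row i≤j j<k = //-cong₂ (H≈H′ _ _ (ℕ.m≤n⇒m≤1+n i≤j) j<k) (H≈H′ _ _ i≤j (ℕ.<⇒≤ j<k))

    ≈-along-col : ∀ {i j} → suc i ≤ℕ j → j ≤ℕ k → H (suc i) j - H i j ≈ H′ (suc i) j - H′ i j
    ≈-along-col i<j j≤k = //-cong₂ (H≈H′ _ _ i<j j≤k) (H≈H′ _ _ (ℕ.<⇒≤ i<j) j≤k)

    ≈-along-diag : ∀ {j} → suc j ≤ℕ k → H (suc j) (suc j) - H j j ≈ H′ (suc j) (suc j) - H′ j j
    ≈-along-diag j<k = //-cong₂ (H≈H′ _ _ ℕ.≤-refl j<k) (H≈H′ _ _ ℕ.≤-refl (ℕ.<⇒≤ j<k))

    IsHive-resp : IsHive F k H → IsHive F k H′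
    IsHive-resp hive = record
      { h00 = trans (sym (H≈H′ 0 0 z≤n z≤n)) h00
      ; R   = λ { (suc i) (suc j) 1≤i i<j@(s≤s i<j′) j≤k → ≤-resp₂
                    (≈-along-row (ℕ.<⇒≤ i<j′) j≤k) (≈-along-row i<j′ j≤k) (R (suc i) (suc j) 1≤i i<j j≤k) }
      ; V   = λ { (suc i) (suc j) 1≤i i≤j@(s≤s i≤j′) j<k → ≤-resp₂
                    (≈-along-row i≤j j<k) (≈-along-row i≤j′ (ℕ.<⇒≤ j<k)) (V (suc i) (suc j) 1≤i i≤j j<k) }
      ; L   = λ { (suc i) j 1≤i i≤j j<k → ≤-resp₂
                    (≈-along-col (s≤s i≤j) j<k) (≈-along-col i≤j (ℕ.<⇒≤ j<k)) (L (suc i) j 1≤i i≤j j<k) }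
      }
      where open IsHive hive

    HiveType-resp : ∀ {lam mu nu} → HiveType F k H lam mu nu → HiveType F k H′ lam mu nu
    HiveType-resp type = record
      { μ-eq = λ { (suc j) 1≤j j<k → trans (μ-eq (suc j) 1≤j j<k) (≈-along-row z≤n j<k) }
      ; λ-eq = λ { (suc j) 1≤j j<k → trans (λ-eq (suc j) 1≤j j<k) (≈-along-diag j<k) }
      ; ν-eq = λ { (suc i) 1≤i i<k → trans (ν-eq (suc i) 1≤i i<k) (≈-along-col i<k ℕ.≤-refl) }
      }
      where open HiveType type

  Φ-injective : ∀ {k} A B → EqT F k (Φ F A) (Φ F B) → EqT F k A B
  Φ-injective {k} A B ΦA≈ΦB i j i≤j j≤k = sumFT-injective i k rows≈ j i≤j j≤k
    where
    rows≈ : ∀ b → i ≤ℕ b → b ≤ℕ k → row A i b ≈ row B i b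
    rows≈ b i≤b b≤k = sumFT-injective 0 b (λ i′ _ i′≤b → ΦA≈ΦB i′ b i′≤b b≤k) i z≤n i≤b

  Φ⁻¹ : Array F → Array F
  Φ⁻¹ H i j = Δ i (λ q → Δ 0 (λ p → H p q) i) j

  Φ-Φ⁻¹ : ∀ {k} H → EqT F k (Φ F (Φ⁻¹ H)) H
  Φ-Φ⁻¹ H i j i≤j _ = begin
    Φ F (Φ⁻¹ H) i j                   ≈⟨ sumFT-cong 0 i (λ p _ p≤i → sumFT-Δ _ j (ℕ.≤-trans p≤i i≤j)) ⟩
    sumFT F (Δ 0 (λ p → H p j)) 0 i   ≈⟨ sumFT-Δ (λ p → H p j) i z≤n ⟩
    H i j                             ∎

  EqT-sym : ∀ {k A B} → EqT F k A B → EqT F k B A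
  EqT-sym A≈B i j i≤j j≤k = sym (A≈B i j i≤j j≤k)

  Φ⁻¹-isLR : ∀ {k H} → IsHive F k H → IsLR F k (Φ⁻¹ H)
  Φ⁻¹-isLR {H = H} hive = IsHive⇒IsLR (IsHive-resp (EqT-sym (Φ-Φ⁻¹ H)) hive)

  Φ⁻¹-LRType : ∀ {k H lam mu nu} → HiveType F k H lam mu nu → LRType F k (Φ⁻¹ H) lam mu nu
  Φ⁻¹-LRType {H = H} type = HiveType⇒LRType (HiveType-resp (EqT-sym (Φ-Φ⁻¹ H)) type)

  laplaceTerm : ∀ n → (Fin (suc n) → Fin (suc n) → Carrier) → Fin (suc n) → Carrier
  laplaceTerm n M c = sign F c * (M zero c * det F n (λ r c′ → M (suc r) (punchIn c c′)))

  -- As for `sumFT`, the underscore is solved to the local sum inside `det`; the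
  -- `with` generalises its parameters to variables so that unification applies.
  mutual
    laplaceSum≡sum : ∀ n (M : Fin (suc n) → Fin (suc n) → Carrier) {m} (h : Fin m → Carrier) → _ ≡ sum h
    laplaceSum≡sum n M {zero}  h = ≡.refl
    laplaceSum≡sum n M {suc m} h = ≡.cong (h zero +_) (laplaceSum≡sum n M (λ x → h (suc x)))

    det-suc : ∀ n M → det F (suc n) M ≡ sum (laplaceTerm n M)
    det-suc zero    M = ≡.refl
    det-suc (suc n) M
      with suc n | M | laplaceTerm (suc n) M zero | laplaceTerm (suc n) M (suc zero)
         | (λ x → laplaceTerm (suc n) M (suc (suc x)))
    ... | n′ | M′ | t₀ | t₁ | h = ≡.cong (λ s → t₀ + (t₁ + s)) (laplaceSum≡sum n′ M′ h)

  det-lowerUnitriangular : ∀ n (M : Fin n → Fin n → Carrier) →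
                           (∀ r → M r r ≈ 1#) → (∀ r c → r <ᶠ c → M r c ≈ 0#) → det F n M ≈ 1#
  det-lowerUnitriangular zero    M _    _     = refl
  det-lowerUnitriangular (suc n) M diag upper = begin
    det F (suc n) M                                               ≡⟨ det-suc n M ⟩
    laplaceTerm n M zero + sum (λ c → laplaceTerm n M (suc c))    ≈⟨ +-cong first rest ⟩
    1# + 0#                                                       ≈⟨ +-identityʳ 1# ⟩
    1#                                                            ∎
    where
    minor≈1 : det F n (λ r c → M (suc r) (suc c)) ≈ 1#
    minor≈1 = det-lowerUnitriangular n _ (λ r → diag (suc r)) (λ r c r<c → upper (suc r) (suc c) (s≤s r<c))

    first : laplaceTerm n M zero ≈ 1#
    first = begin
      1# * (M zero zero * det F n (λ r c → M (suc r) (suc c)))  ≈⟨ *-identityˡ _ ⟩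
      M zero zero * det F n (λ r c → M (suc r) (suc c))         ≈⟨ *-cong (diag zero) minor≈1 ⟩
      1# * 1#                                                   ≈⟨ *-identityˡ 1# ⟩
      1#                                                        ∎

    rest : sum (λ c → laplaceTerm n M (suc c)) ≈ 0#
    rest = trans (sum-cong-≋ vanishes) (sum-replicate-zero n)
      where
      vanishes : ∀ c → laplaceTerm n M (suc c) ≈ 0#
      vanishes c = trans (*-congˡ (trans (*-congʳ (upper zero (suc c) (s≤s z≤n))) (zeroˡ _))) (zeroʳ _)

  basis-diag : ∀ p q → basis F (p , q) p q ≈ 1#
  basis-diag p q with p ℕ.≟ p | q ℕ.≟ q
  ... | yes _ | yes _   = refl
  ... | yes _ | no  q≢q = contradiction ≡.refl q≢q
  ... | no p≢p | _      = contradiction ≡.refl p≢p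

  basis-off : ∀ p q i j → ¬ p ≡ i ⊎ ¬ q ≡ j → basis F (p , q) i j ≈ 0#
  basis-off p q i j off with p ℕ.≟ i | q ℕ.≟ j | off
  ... | yes p≡i | yes _   | inj₁ p≢i = contradiction p≡i p≢i
  ... | yes _   | yes q≡j | inj₂ q≢j = contradiction q≡j q≢j
  ... | yes _   | no  _   | _        = refl
  ... | no  _   | _       | _        = refl

  Φ-basis-vanishes : ∀ {x i j} → x ≰ₓ (i , j) → Φ F (basis F x) i j ≈ 0#
  Φ-basis-vanishes {p , q} {i} {j} x≰ij =
    sumFT-zero 0 i (λ t _ t≤i → sumFT-zero t j (λ t′ _ t′≤j → basis-off p q t t′ (off t≤i t′≤j x≰ij)))
    where
    off : ∀ {t t′} → t ≤ℕ i → t′ ≤ℕ j → (p , q) ≰ₓ (i , j) → ¬ p ≡ t ⊎ ¬ q ≡ t′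
    off t≤i _ (inj₁ i<p) = inj₁ (λ { ≡.refl → ℕ.<⇒≱ i<p t≤i })
    off _ t′≤j (inj₂ j<q) = inj₂ (λ { ≡.refl → ℕ.<⇒≱ j<q t′≤j })

  Φ-basis-diag : ∀ {p q} → p ≤ℕ q → Φ F (basis F (p , q)) p q ≈ 1#
  Φ-basis-diag {p} {q} p≤q = begin
    Φ F e p q  ≈⟨ sumFT-single 0 p z≤n ℕ.≤-refl other-rows ⟩
    row e p q  ≈⟨ sumFT-single p q p≤q ℕ.≤-refl (λ t _ _ t≢q → basis-off p q p t (inj₂ (≢-sym t≢q))) ⟩
    e p q      ≈⟨ basis-diag p q ⟩
    1#         ∎
    where
    e : Array F
    e = basis F (p , q)

    other-rows : ∀ t → 0 ≤ℕ t → t ≤ℕ p → ¬ t ≡ p → row e t q ≈ 0#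
    other-rows t _ _ t≢p = sumFT-zero t q (λ t′ _ _ → basis-off p q t t′ (inj₁ (≢-sym t≢p)))

  MatΦ≡ : ∀ k r c → MatΦ F k r c ≡ Φ F (basis F (lookup (indices k) c))
                                       (proj₁ (lookup (indices k) r)) (proj₂ (lookup (indices k) r))
  MatΦ≡ k r c with lookup (indices k) r | lookup (indices k) c
  ... | _ , _ | _ = ≡.refl

  det-MatΦ : ∀ k → det F _ (MatΦ F k) ≈ 1#
  det-MatΦ k = det-lowerUnitriangular _ (MatΦ F k) diag upper
    where
    diag : ∀ r → MatΦ F k r r ≈ 1#
    diag r = trans (reflexive (MatΦ≡ k r r))
                   (Φ-basis-diag (proj₁ (All.lookup (indices-inTriangle k) (∈-lookup r))))

    upper : ∀ r c → r <ᶠ c → MatΦ F k r c ≈ 0#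
    upper r c r<c = trans (reflexive (MatΦ≡ k r c))
                          (Φ-basis-vanishes (lookup-AllPairs (indices-linearExtension k) r<c))

theorem4p1 : ∀ {c ℓ₁ ℓ₂} (F : OrderedField c ℓ₁ ℓ₂) (k : ℕ) → 1 ≤ℕ k →
    let open OrderedField F in
    -- volume preserving: det Φ_k = 1
    (det F _ (MatΦ F k) ≈ 1#)
    -- Φ_k maps LR_k into H_k
    × (∀ A → IsLR F k A → IsHive F k (Φ F A))
    -- ... injectively
    × (∀ A B → IsLR F k A → IsLR F k B → EqT F k (Φ F A) (Φ F B) → EqT F k A B)
    -- ... and onto H_k
    × (∀ H → IsHive F k H → Σ (Array F) λ A → IsLR F k A × EqT F k (Φ F A) H)
    -- Φ_k maps LR_k(λ,μ,ν) onto H_k(λ,μ,ν) for all λ, μ, ν ∈ D_k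
    × (∀ lam mu nu → InD F k lam → InD F k mu → InD F k nu →
         (∀ A → IsLR F k A → LRType F k A lam mu nu →
            IsHive F k (Φ F A) × HiveType F k (Φ F A) lam mu nu)
         × (∀ H → IsHive F k H → HiveType F k H lam mu nu →
            Σ (Array F) λ A → IsLR F k A × LRType F k A lam mu nu × EqT F k (Φ F A) H))
theorem4p1 F k _ =
    det-MatΦ F k
  , (λ _ → IsLR⇒IsHive F)
  , (λ A B _ _ → Φ-injective F A B)
  , (λ H hive → Φ⁻¹ F H , Φ⁻¹-isLR F hive , Φ-Φ⁻¹ F H)
  , λ _ _ _ _ _ _ →
      (λ _ lr type → IsLR⇒IsHive F lr , LRType⇒HiveType F type)
    , (λ H hive type → Φ⁻¹ F H , Φ⁻¹-isLR F hive , Φ⁻¹-LRType F type , Φ-Φ⁻¹ F H)
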